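{- Let $q$ be a prime power and let $n\ge r\ge 3$ be integers. Let $\Psi_{q,n}^{(r-1,r)}:\mathcal{H}_n^{(r-1)}(\mathbb{F}_q)\to\mathcal{H}_n^{(r)}(\mathbb{F}_q)$ be defined by $(\Psi_{q,n}^{(r-1,r)}f)(e)=\sum_{e'\subseteq e,\ |e'|=r-1} f(e')$ for every $r$-element subset $e$ of the vertex set. Suppose $f,g\in\mathcal{H}_n^{(r-1)}(\mathbb{F}_q)$ satisfy $\Psi_{q,n}^{(r-1,r)}f=\Psi_{q,n}^{(r-1,r)}g$ and $f\ne g$. Then $f$ and $g$ differ on at least $n-r+2$ hyperedges, i.e. $|\{e'\in E(K_n^{(r-1)}) : f(e')\ne g(e')\}|\ge n-r+2$.
   Context: $\mathbb{F}_q$ denotes the finite field of order $q$. For $2\le k\le n$, $K_n^{(k)}$ is the complete $k$-uniform hypergraph on a fixed $n$-element vertex set $V$: its hyperedges are all $k$-element subsets of $V$. $\mathcal{H}_n^{(k)}(\mathbb{F}_q)$ denotes the set of all maps $f:E(K_n^{(k)})\to\mathbb{F}_q$, a vector space over $\mathbb{F}_q$ under pointwise operations. -}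

module Defs where

open import Level using (_⊔_) renaming (suc to lsuc)
open import Data.Nat using (ℕ; zero; suc; _^_; _≟_)
open import Data.Nat.Primality using (Prime)
open import Data.Bool using (true; false)
open import Data.Fin using (Fin)
open import Data.Fin.Subset using (Subset; ∣_∣; _⊆_)
open import Data.Fin.Subset.Properties using (_⊆?_)
open import Data.Vec using (_∷_; [])
open import Data.List using (List; []; _∷_; map; _++_; foldr)
open import Data.Product using (Σ; ∃; ∃₂; _×_; _,_; proj₁)
open import Relation.Nullary using (¬_; yes; no)
open import Relation.Binary.PropositionalEquality as ≡ using (_≡_)
open import Algebra.Bundles using (CommutativeRing)
open import Function.Bundles using (Bijection)

record Field (c ℓ : Level.Level) : Set (lsuc (c ⊔ ℓ)) where
  field
    commutativeRing : CommutativeRing c ℓ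
  open CommutativeRing commutativeRing public
  field
    1≉0     : ¬ (1# ≈ 0#)
    inverse : ∀ x → ¬ (x ≈ 0#) → ∃ λ y → (x * y) ≈ 1#

HasOrder : ∀ {c ℓ} → Field c ℓ → ℕ → Set (c ⊔ ℓ)
HasOrder F q = Bijection (Field.setoid F) (≡.setoid (Fin q))

IsPrimePower : ℕ → Set
IsPrimePower q = ∃₂ λ p k → Prime p × q ≡ p ^ suc k

Edge : ℕ → ℕ → Set
Edge n k = Σ (Subset n) (λ s → ∣ s ∣ ≡ k)

Hyp : ∀ {c ℓ} → Field c ℓ → ℕ → ℕ → Set c
Hyp F n k = Edge n k → Field.Carrier F

allSubsets : (n : ℕ) → List (Subset n)
allSubsets zero = [] ∷ []
allSubsets (suc n) = map (false ∷_) (allSubsets n) ++ map (true ∷_) (allSubsets n)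

subEdges : ∀ {n} k → Subset n → List (Edge n k)
subEdges {n} k s = go (allSubsets n)
  where
  go : List (Subset n) → List (Edge n k)
  go [] = []
  go (t ∷ ts) with ∣ t ∣ ≟ k | t ⊆? s
  ... | yes p | yes _ = (t , p) ∷ go ts
  ... | _     | _     = go ts

Ψ : ∀ {c ℓ} (F : Field c ℓ) {n} k l → Hyp F n k → Hyp F n l
Ψ F k l f e = foldr (λ e' acc → f e' + acc) 0# (subEdges k (proj₁ e))
  where open Field F

{-# OPTIONS --safe #-}
-- Pick an (r−1)-edge s₀ on which f and g differ. For a vertex v ∉ s₀ the sums
-- defining Ψf and Ψg at the r-edge s₀ ∪ {v} agree, so f and g also differ on some
-- other (r−1)-subset of s₀ ∪ {v}; having the size of s₀ without being s₀, it
-- contains v. Different vertices thus give different edges, and together with s₀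
-- these are 1 + (n − r + 1) edges.
module Submission where

open import Defs
open import Data.Nat using (ℕ; zero; suc; _≤_; _∸_; _+_; s≤s)
open import Data.Nat.Properties using (≡-irrelevant; suc-injective; <-irrefl; +-∸-assoc; +-comm)
import Data.Nat as ℕ
open import Data.Bool using (true; false)
open import Data.Fin using (Fin; zero; suc)
import Data.Fin.Properties as Fin
open import Data.Fin.Subset using (Subset; ∣_∣; _⊆_; _∈_; _∉_; _∪_; ⁅_⁆; ∁; ⊤; inside; outside)
open import Data.Fin.Subset.Properties
  using (_⊆?_; _∈?_; drop-∷-⊆; p⊆q⇒∣p∣≤∣q∣; x∈p∪q⁻; x∈⁅y⁆⇒x≡y; p⊆p∪q; ∣∁p∣≡n∸∣p∣;
         x∈∁p⇒x∉p; ∪-identityʳ; ⊆⊤)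
open import Data.Vec using (_∷_; []; here; there)
import Data.Vec.Properties as Vec
open import Data.List using (List; []; _∷_; _++_; map; foldr)
open import Data.List.Properties using (map-++; ++-assoc)
open import Data.List.Membership.Propositional using (find) renaming (_∈_ to _∈ₗ_)
open import Data.List.Membership.Propositional.Properties using (∈-++⁺ʳ)
open import Data.List.Relation.Unary.All as All using (All; []; _∷_; all?)
open import Data.List.Relation.Unary.All.Properties using (++⁺; ++⁻; map⁺; ¬All⇒Any¬)
open import Data.List.Relation.Unary.Any using (here)
open import Data.Product using (∃; ∃₂; _×_; _,_; proj₁; proj₂)
open import Data.Sum using (inj₁; inj₂)
open import Data.Empty using (⊥-elim)
open import Relation.Nullary using (¬_; yes; no)
open import Relation.Binary using (Decidable)
open import Relation.Binary.PropositionalEquality as ≡ using (_≡_; _≢_)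
open import Function.Bundles using (Bijection)
open import Algebra.Bundles using (Group)

p⊆q∧∣p∣≡∣q∣⇒p≡q : ∀ {n} {p q : Subset n} → p ⊆ q → ∣ p ∣ ≡ ∣ q ∣ → p ≡ q
p⊆q∧∣p∣≡∣q∣⇒p≡q {p = []}          {[]}          _   _ = ≡.refl
p⊆q∧∣p∣≡∣q∣⇒p≡q {p = outside ∷ p} {outside ∷ q} p⊆q eq =
  ≡.cong (outside ∷_) (p⊆q∧∣p∣≡∣q∣⇒p≡q (drop-∷-⊆ p⊆q) eq)
p⊆q∧∣p∣≡∣q∣⇒p≡q {p = inside ∷ p}  {inside ∷ q}  p⊆q eq =
  ≡.cong (inside ∷_) (p⊆q∧∣p∣≡∣q∣⇒p≡q (drop-∷-⊆ p⊆q) (suc-injective eq))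
p⊆q∧∣p∣≡∣q∣⇒p≡q {p = inside ∷ p}  {outside ∷ q} p⊆q eq with p⊆q here
... | ()
p⊆q∧∣p∣≡∣q∣⇒p≡q {p = outside ∷ p} {inside ∷ q}  p⊆q eq =
  ⊥-elim (<-irrefl eq (s≤s (p⊆q⇒∣p∣≤∣q∣ (drop-∷-⊆ p⊆q))))

∣p∪⁅x⁆∣≡1+∣p∣ : ∀ {n} (p : Subset n) {x} → x ∉ p → ∣ p ∪ ⁅ x ⁆ ∣ ≡ suc ∣ p ∣
∣p∪⁅x⁆∣≡1+∣p∣ (outside ∷ p) {zero}  x∉p = ≡.cong (λ q → suc ∣ q ∣) (∪-identityʳ p)
∣p∪⁅x⁆∣≡1+∣p∣ (inside ∷ p)  {zero}  x∉p = ⊥-elim (x∉p here)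
∣p∪⁅x⁆∣≡1+∣p∣ (outside ∷ p) {suc x} x∉p = ∣p∪⁅x⁆∣≡1+∣p∣ p (λ x∈p → x∉p (there x∈p))
∣p∪⁅x⁆∣≡1+∣p∣ (inside ∷ p)  {suc x} x∉p = ≡.cong suc (∣p∪⁅x⁆∣≡1+∣p∣ p (λ x∈p → x∉p (there x∈p)))

x∈p∪⁅y⁆∧x∉p⇒x≡y : ∀ {n} {p : Subset n} {x y} → x ∈ p ∪ ⁅ y ⁆ → x ∉ p → x ≡ y
x∈p∪⁅y⁆∧x∉p⇒x≡y {p = p} {y = y} x∈ x∉p with x∈p∪q⁻ p ⁅ y ⁆ x∈
... | inj₁ x∈p = ⊥-elim (x∉p x∈p)
... | inj₂ x∈y = x∈⁅y⁆⇒x≡y y x∈y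

p⊆q∪⁅x⁆∧p≢q⇒x∈p : ∀ {n} {p q : Subset n} {x} → p ⊆ q ∪ ⁅ x ⁆ → ∣ p ∣ ≡ ∣ q ∣ → p ≢ q → x ∈ p
p⊆q∪⁅x⁆∧p≢q⇒x∈p {p = p} {q} {x} p⊆q∪x ∣p∣≡∣q∣ p≢q with x ∈? p
... | yes x∈p = x∈p
... | no  x∉p = ⊥-elim (p≢q (p⊆q∧∣p∣≡∣q∣⇒p≡q p⊆q ∣p∣≡∣q∣))
  where
  p⊆q : p ⊆ q
  p⊆q {y} y∈p with x∈p∪q⁻ q ⁅ x ⁆ (p⊆q∪x y∈p)
  ... | inj₁ y∈q = y∈q
  ... | inj₂ y∈x = ⊥-elim (x∉p (≡.subst (_∈ p) (x∈⁅y⁆⇒x≡y x y∈x) y∈p))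

enumerate : ∀ {n} (p : Subset n) → Fin ∣ p ∣ → Fin n
enumerate (inside ∷ p)  zero    = zero
enumerate (inside ∷ p)  (suc i) = suc (enumerate p i)
enumerate (outside ∷ p) i       = suc (enumerate p i)

enumerate-∈ : ∀ {n} (p : Subset n) i → enumerate p i ∈ p
enumerate-∈ (inside ∷ p)  zero    = here
enumerate-∈ (inside ∷ p)  (suc i) = there (enumerate-∈ p i)
enumerate-∈ (outside ∷ p) i       = there (enumerate-∈ p i)

enumerate-injective : ∀ {n} (p : Subset n) {i j} → enumerate p i ≡ enumerate p j → i ≡ j
enumerate-injective (inside ∷ p)  {zero}  {zero}  _  = ≡.refl
enumerate-injective (inside ∷ p)  {suc i} {suc j} eq =
  ≡.cong suc (enumerate-injective p (Fin.suc-injective eq))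
enumerate-injective (outside ∷ p) eq = enumerate-injective p (Fin.suc-injective eq)

∷-≢ : ∀ {n} b {s t : Subset n} → t ≢ s → b ∷ t ≢ b ∷ s
∷-≢ b t≢s eq = t≢s (Vec.∷-injectiveʳ eq)

allSubsets-split : ∀ n (s : Subset n) → ∃₂ λ xs ys →
                   allSubsets n ≡ xs ++ s ∷ ys × All (_≢ s) xs × All (_≢ s) ys
allSubsets-split zero [] = [] , [] , ≡.refl , [] , []
allSubsets-split (suc n) (b ∷ s) with allSubsets-split n s
... | xs , ys , eq , xs≢s , ys≢s with b
...   | false =
  map (false ∷_) xs , map (false ∷_) ys ++ map (true ∷_) (allSubsets n) ,
  ≡.trans (≡.cong (λ zs → map (false ∷_) zs ++ map (true ∷_) (allSubsets n)) eq)
    (≡.trans (≡.cong (_++ map (true ∷_) (allSubsets n)) (map-++ (false ∷_) xs (s ∷ ys)))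
             (++-assoc (map (false ∷_) xs) _ _)) ,
  map⁺ (All.map (∷-≢ false) xs≢s) ,
  ++⁺ (map⁺ (All.map (∷-≢ false) ys≢s)) (map⁺ (All.tabulate λ _ ()))
...   | true =
  map (false ∷_) (allSubsets n) ++ map (true ∷_) xs , map (true ∷_) ys ,
  ≡.trans (≡.cong (λ zs → map (false ∷_) (allSubsets n) ++ map (true ∷_) zs) eq)
    (≡.trans (≡.cong (map (false ∷_) (allSubsets n) ++_) (map-++ (true ∷_) xs (s ∷ ys)))
             (≡.sym (++-assoc (map (false ∷_) (allSubsets n)) _ _))) ,
  ++⁺ (map⁺ (All.tabulate λ _ ())) (map⁺ (All.map (∷-≢ true) xs≢s)) ,
  map⁺ (All.map (∷-≢ true) ys≢s)

-- `subEdges` filters `allSubsets n` through a local function; abstracting the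
-- list lets unification give that function a name.
mutual
  subEdgesFilter : ∀ {n} k (s : Subset n) → List (Subset n) → List (Edge n k)
  subEdgesFilter = _

  subEdges≡subEdgesFilter : ∀ {n} k (s : Subset n) → subEdges k s ≡ subEdgesFilter k s (allSubsets n)
  subEdges≡subEdgesFilter {n} k s with allSubsets n
  ... | _ = ≡.refl

module _ {n} (k : ℕ) (s : Subset n) where

  subEdgesFilter-++ : ∀ ts us → subEdgesFilter k s (ts ++ us) ≡ subEdgesFilter k s ts ++ subEdgesFilter k s us
  subEdgesFilter-++ []       us = ≡.refl
  subEdgesFilter-++ (t ∷ ts) us with ∣ t ∣ ℕ.≟ k | t ⊆? s
  ... | yes p | yes _ = ≡.cong ((t , p) ∷_) (subEdgesFilter-++ ts us)
  ... | yes _ | no  _ = subEdgesFilter-++ ts us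
  ... | no  _ | _     = subEdgesFilter-++ ts us

  subEdgesFilter-∷ : ∀ {t} (p : ∣ t ∣ ≡ k) → t ⊆ s → ∀ ts →
                     subEdgesFilter k s (t ∷ ts) ≡ (t , p) ∷ subEdgesFilter k s ts
  subEdgesFilter-∷ {t} p t⊆s ts with ∣ t ∣ ℕ.≟ k | t ⊆? s
  ... | yes p′ | yes _   = ≡.cong (λ p″ → (t , p″) ∷ subEdgesFilter k s ts) (≡-irrelevant p′ p)
  ... | yes _  | no t⊈s = ⊥-elim (t⊈s t⊆s)
  ... | no ¬p  | _       = ⊥-elim (¬p p)

  subEdgesFilter-All : ∀ {P : Subset n → Set} ts → All P ts →
                       All (λ e → P (proj₁ e) × proj₁ e ⊆ s) (subEdgesFilter k s ts)
  subEdgesFilter-All []       []         = []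
  subEdgesFilter-All (t ∷ ts) (pt ∷ pts) with ∣ t ∣ ℕ.≟ k | t ⊆? s
  ... | yes _ | yes t⊆s = (pt , t⊆s) ∷ subEdgesFilter-All ts pts
  ... | yes _ | no  _   = subEdgesFilter-All ts pts
  ... | no  _ | _       = subEdgesFilter-All ts pts

subEdges-split : ∀ {n k} {s t : Subset n} (p : ∣ t ∣ ≡ k) → t ⊆ s → ∃₂ λ xs ys →
                 subEdges k s ≡ xs ++ (t , p) ∷ ys × All (λ e → proj₁ e ≢ t × proj₁ e ⊆ s) (xs ++ ys)
subEdges-split {n} {k} {s} {t} p t⊆s with allSubsets-split n t
... | ts , us , eq , ts≢t , us≢t =
  subEdgesFilter k s ts , subEdgesFilter k s us ,
  (begin
    subEdges k s                                         ≡⟨ subEdges≡subEdgesFilter k s ⟩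
    subEdgesFilter k s (allSubsets n)                    ≡⟨ ≡.cong (subEdgesFilter k s) eq ⟩
    subEdgesFilter k s (ts ++ t ∷ us)                    ≡⟨ subEdgesFilter-++ k s ts (t ∷ us) ⟩
    subEdgesFilter k s ts ++ subEdgesFilter k s (t ∷ us) ≡⟨ ≡.cong (subEdgesFilter k s ts ++_) (subEdgesFilter-∷ k s p t⊆s us) ⟩
    subEdgesFilter k s ts ++ (t , p) ∷ subEdgesFilter k s us ∎) ,
  ++⁺ (subEdgesFilter-All k s ts ts≢t) (subEdgesFilter-All k s us us≢t)
  where open ≡.≡-Reasoning

∈-subEdges : ∀ {n k} {s t : Subset n} (p : ∣ t ∣ ≡ k) → t ⊆ s → (t , p) ∈ₗ subEdges k s
∈-subEdges p t⊆s with subEdges-split p t⊆s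
... | xs , _ , eq , _ = ≡.subst ((_ , p) ∈ₗ_) (≡.sym eq) (∈-++⁺ʳ xs (here ≡.refl))

module ListSum {c ℓ} (G : Group c ℓ) where
  open Group G
  open import Algebra.Properties.Group G using (∙-cancelˡ; ∙-cancelʳ)
  open import Relation.Binary.Reasoning.Setoid setoid

  ∑ : ∀ {a} {A : Set a} → (A → Carrier) → List A → Carrier
  ∑ f = foldr (λ x acc → f x ∙ acc) ε

  module _ {a} {A : Set a} where

    ∑-++ : ∀ (f : A → Carrier) xs ys → ∑ f (xs ++ ys) ≈ ∑ f xs ∙ ∑ f ys
    ∑-++ f []       ys = sym (identityˡ _)
    ∑-++ f (x ∷ xs) ys = trans (∙-congˡ (∑-++ f xs ys)) (sym (assoc _ _ _))

    ∑-cong : ∀ {f g : A → Carrier} {xs} → All (λ x → f x ≈ g x) xs → ∑ f xs ≈ ∑ g xs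
    ∑-cong []           = refl
    ∑-cong (fx≈gx ∷ xs) = ∙-cong fx≈gx (∑-cong xs)

    ∑-cancel : ∀ (f g : A → Carrier) xs x ys → ∑ f (xs ++ x ∷ ys) ≈ ∑ g (xs ++ x ∷ ys) →
               All (λ y → f y ≈ g y) (xs ++ ys) → f x ≈ g x
    ∑-cancel f g xs x ys ∑f≈∑g f≈g = ∙-cancelʳ (∑ g ys) (f x) (g x) (∙-cancelˡ (∑ g xs) _ _ (begin
      ∑ g xs ∙ (f x ∙ ∑ g ys) ≈⟨ ∙-cong (sym (∑-cong f≈g-xs)) (∙-congˡ (sym (∑-cong f≈g-ys))) ⟩
      ∑ f xs ∙ (f x ∙ ∑ f ys) ≈⟨ sym (∑-++ f xs (x ∷ ys)) ⟩
      ∑ f (xs ++ x ∷ ys)      ≈⟨ ∑f≈∑g ⟩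
      ∑ g (xs ++ x ∷ ys)      ≈⟨ ∑-++ g xs (x ∷ ys) ⟩
      ∑ g xs ∙ (g x ∙ ∑ g ys) ∎))
      where
      f≈g-xs : All (λ y → f y ≈ g y) xs
      f≈g-xs = proj₁ (++⁻ xs f≈g)

      f≈g-ys : All (λ y → f y ≈ g y) ys
      f≈g-ys = proj₂ (++⁻ xs f≈g)

Differences : ∀ {c ℓ} (F : Field c ℓ) {n k} (f g : Hyp F n k) → ℕ → Set ℓ
Differences F {n} {k} f g m =
  ∃ λ (h : Fin m → Edge n k) →
    (∀ i j → proj₁ (h i) ≡ proj₁ (h j) → i ≡ j) × (∀ i → ¬ Field._≈_ F (f (h i)) (g (h i)))

HasOrder⇒decidable : ∀ {c ℓ} (F : Field c ℓ) q → HasOrder F q → Decidable (Field._≈_ F)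
HasOrder⇒decidable F q ∣F∣≡q x y with Bijection.to ∣F∣≡q x Fin.≟ Bijection.to ∣F∣≡q y
... | yes eq = yes (Bijection.injective ∣F∣≡q eq)
... | no ¬eq = no (λ x≈y → ¬eq (Bijection.cong ∣F∣≡q x≈y))

module _ {c ℓ} (F : Field c ℓ) (_≟_ : Decidable (Field._≈_ F)) where
  open Field F
  open ListSum +-group using (∑; ∑-cancel)

  differing-edge : ∀ {n k} (f g : Hyp F n k) → ¬ (∀ e → f e ≈ g e) → ∃ λ e → ¬ f e ≈ g e
  differing-edge {k = k} f g f≉g with all? (λ e → f e ≟ g e) (subEdges k ⊤)
  ... | yes f≈g = ⊥-elim (f≉g λ (t , p) → All.lookup f≈g (∈-subEdges p ⊆⊤))
  ... | no  f≉g′ = let e , _ , fe≉ge = find (¬All⇒Any¬ (λ e → f e ≟ g e) _ f≉g′) in e , fe≉ge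

  other-differing-subedge :
    ∀ {n k l} (f g : Hyp F n k) {t} (p : ∣ t ∣ ≡ k) (e : Edge n l) → t ⊆ proj₁ e →
    Ψ F k l f e ≈ Ψ F k l g e → ¬ f (t , p) ≈ g (t , p) →
    ∃ λ x → (proj₁ x ≢ t × proj₁ x ⊆ proj₁ e) × ¬ f x ≈ g x
  other-differing-subedge f g {t} p e t⊆e Ψf≈Ψg ft≉gt with subEdges-split p t⊆e
  ... | xs , ys , eq , others =
    let x , x∈ , fx≉gx = find (¬All⇒Any¬ (λ x → f x ≟ g x) (xs ++ ys) others-agree⇒t-agrees)
    in x , All.lookup others x∈ , fx≉gx
    where
    others-agree⇒t-agrees : ¬ All (λ x → f x ≈ g x) (xs ++ ys)
    others-agree⇒t-agrees f≈g = ft≉gt (∑-cancel f g xs (t , p) ys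
      (≡.subst (λ es → ∑ f es ≈ ∑ g es) eq Ψf≈Ψg) f≈g)

  differences : ∀ {n k} (f g : Hyp F n k) → (∀ e → Ψ F k (suc k) f e ≈ Ψ F k (suc k) g e) →
                ∀ s₀ → ¬ f s₀ ≈ g s₀ → Differences F f g (suc (n ∸ k))
  differences {n} {k} f g Ψf≈Ψg (s₀ , ∣s₀∣≡k) fs₀≉gs₀ =
    ≡.subst (Differences F f g) (≡.cong suc (≡.trans (∣∁p∣≡n∸∣p∣ s₀) (≡.cong (n ∸_) ∣s₀∣≡k)))
      (h , h-injective , h-differs)
    where
    v : Fin ∣ ∁ s₀ ∣ → Fin n
    v = enumerate (∁ s₀)

    v∉s₀ : ∀ i → v i ∉ s₀
    v∉s₀ i = x∈∁p⇒x∉p (enumerate-∈ (∁ s₀) i)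

    extension : Fin ∣ ∁ s₀ ∣ → Edge n (suc k)
    extension i = s₀ ∪ ⁅ v i ⁆ , ≡.trans (∣p∪⁅x⁆∣≡1+∣p∣ s₀ (v∉s₀ i)) (≡.cong suc ∣s₀∣≡k)

    witness : ∀ i → ∃ λ x → (proj₁ x ≢ s₀ × proj₁ x ⊆ s₀ ∪ ⁅ v i ⁆) × ¬ f x ≈ g x
    witness i = other-differing-subedge f g ∣s₀∣≡k (extension i) (p⊆p∪q _) (Ψf≈Ψg (extension i)) fs₀≉gs₀

    h : Fin (suc ∣ ∁ s₀ ∣) → Edge n k
    h zero    = s₀ , ∣s₀∣≡k
    h (suc i) = proj₁ (witness i)

    h-differs : ∀ i → ¬ f (h i) ≈ g (h i)
    h-differs zero    = fs₀≉gs₀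
    h-differs (suc i) = proj₂ (proj₂ (witness i))

    h≢s₀ : ∀ i → proj₁ (h (suc i)) ≢ s₀
    h≢s₀ i = proj₁ (proj₁ (proj₂ (witness i)))

    h⊆s₀∪v : ∀ i → proj₁ (h (suc i)) ⊆ s₀ ∪ ⁅ v i ⁆
    h⊆s₀∪v i = proj₂ (proj₁ (proj₂ (witness i)))

    v∈h : ∀ i → v i ∈ proj₁ (h (suc i))
    v∈h i = p⊆q∪⁅x⁆∧p≢q⇒x∈p (h⊆s₀∪v i) (≡.trans (proj₂ (h (suc i))) (≡.sym ∣s₀∣≡k)) (h≢s₀ i)

    h-injective : ∀ i j → proj₁ (h i) ≡ proj₁ (h j) → i ≡ j
    h-injective zero    zero    _  = ≡.refl
    h-injective zero    (suc j) eq = ⊥-elim (h≢s₀ j (≡.sym eq))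
    h-injective (suc i) zero    eq = ⊥-elim (h≢s₀ i eq)
    h-injective (suc i) (suc j) eq = ≡.cong suc (enumerate-injective (∁ s₀)
      (x∈p∪⁅y⁆∧x∉p⇒x≡y (h⊆s₀∪v j (≡.subst (v i ∈_) eq (v∈h i))) (v∉s₀ i)))

theorem3 : ∀ {c ℓ} (F : Field c ℓ) (q : ℕ) → IsPrimePower q → HasOrder F q →
           (n r : ℕ) → 3 ≤ r → r ≤ n →
           (f g : Hyp F n (r ∸ 1)) →
           (∀ e → Field._≈_ F (Ψ F (r ∸ 1) r f e) (Ψ F (r ∸ 1) r g e)) →
           ¬ (∀ e' → Field._≈_ F (f e') (g e')) →
           ∃ λ (h : Fin ((n ∸ r) + 2) → Edge n (r ∸ 1)) →
             (∀ i j → proj₁ (h i) ≡ proj₁ (h j) → i ≡ j) ×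
             (∀ i → ¬ Field._≈_ F (f (h i)) (g (h i)))
theorem3 F q _ ∣F∣≡q n (suc k) _ r≤n f g Ψf≈Ψg f≉g =
  ≡.subst (Differences F f g) (≡.trans (≡.cong suc (+-∸-assoc 1 r≤n)) (+-comm 2 (n ∸ suc k)))
    (differences F _≟_ f g Ψf≈Ψg s₀ fs₀≉gs₀)
  where
  _≟_ : Decidable (Field._≈_ F)
  _≟_ = HasOrder⇒decidable F q ∣F∣≡q

  s₀ : Edge n k
  s₀ = proj₁ (differing-edge F _≟_ f g f≉g)

  fs₀≉gs₀ : ¬ Field._≈_ F (f s₀) (g s₀)
  fs₀≉gs₀ = proj₂ (differing-edge F _≟_ f g f≉g)
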